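{- Let $m\ge 1$ and let $a^1,a^2,\dots,a^n$ be a sequence of moves starting from $a^1=0^{m}=(0,\dots,0)\in\mathbb{N}^m$. Then for every $t$, every $l\ge 1$ and every $j$ with $1\le j$ and $j+l-1\le m$, one has $\sum_{s=0}^{l-1} a^t_{j+s}\le l+1$; i.e. no state in the sequence contains a block of $l$ consecutive entries whose sum exceeds $l+1$.
   Context: A state is a tuple $a=(a_1,\dots,a_m)$ of nonnegative integers. A move from a state $a$ to a state $a'$ is performed as follows: choose a triggering position $T\in\{1,\dots,m\}$ with $a_T=0$; set $a'_T=2$; if there exists $j<T$ with $a_j>0$, take the largest such $j$ and set $a'_j=a_j-1$; if there exists $j>T$ with $a_j>0$, take the smallest such $j$ and set $a'_j=a_j-1$; all other entries are unchanged. A sequence of moves is a sequence of states $a^1,\dots,a^n$ where each $a^{t+1}$ is obtained from $a^t$ by a move. -}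

module Defs where

open import Data.Nat using (ℕ; zero; suc; _+_; _<_; _≤_; _<?_)
open import Data.Fin using (Fin; toℕ; fromℕ<)
open import Data.Product using (Σ; _×_; ∃)
open import Data.Sum using (_⊎_)
open import Relation.Nullary using (¬_; yes; no)
open import Relation.Binary.PropositionalEquality using (_≡_; _≢_)

-- A state of length m: entries a_1..a_m, indexed here by Fin m (0-based).
State : ℕ → Set
State m = Fin m → ℕ

zeroState : (m : ℕ) → State m
zeroState m _ = 0

LeftNearest : {m : ℕ} → State m → Fin m → Fin m → Set
LeftNearest a T j =
  (toℕ j < toℕ T) × (0 < a j) × (∀ k → toℕ j < toℕ k → toℕ k < toℕ T → a k ≡ 0)

RightNearest : {m : ℕ} → State m → Fin m → Fin m → Set
RightNearest a T j =
  (toℕ T < toℕ j) × (0 < a j) × (∀ k → toℕ T < toℕ k → toℕ k < toℕ j → a k ≡ 0)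

Nearest : {m : ℕ} → State m → Fin m → Fin m → Set
Nearest a T j = LeftNearest a T j ⊎ RightNearest a T j

MoveAt : {m : ℕ} → State m → Fin m → State m → Set
MoveAt a T a' =
  (a T ≡ 0) × (a' T ≡ 2) ×
  (∀ i → i ≢ T →
     (Nearest a T i → suc (a' i) ≡ a i) × (¬ Nearest a T i → a' i ≡ a i))

Move : {m : ℕ} → State m → State m → Set
Move a a' = ∃ λ T → MoveAt a T a'

-- Entry at 0-based position i (0 outside the range).
entry : {m : ℕ} → State m → ℕ → ℕ
entry {m} a i with i <? m
... | yes p = a (fromℕ< p)
... | no _  = 0

blockSum : {m : ℕ} → State m → ℕ → ℕ → ℕ
blockSum a j zero    = 0
blockSum a j (suc l) = entry a j + blockSum a (suc j) l

-- A sequence of moves a^1..a^n (indexed 0..n-1) starting at the zero state.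
IsMoveSequenceFromZero : {m n : ℕ} → (Fin n → State m) → Set
IsMoveSequenceFromZero {m} {n} seq =
  (∀ (i : Fin n) → toℕ i ≡ 0 → seq i ≡ zeroState m) ×
  (∀ (i k : Fin n) → suc (toℕ i) ≡ toℕ k → Move (seq i) (seq k))

-- The invariant "every block of l consecutive entries sums to at most l + 1" holds
-- at the zero state and is preserved by every move.  A block avoiding the
-- triggering position T only loses mass.  A block containing T splits into a left
-- part of length L, the entry 2 at T, and a right part of length R.  If the left
-- part of the old state is not all zero, it contains the nonzero entry nearest to
-- the left of T, which the move decrements, so its new sum is at most (L + 1) - 1;
-- otherwise it is 0.  The same holds on the right, and L + 2 + R = l + 1.
module Submission where

open import Defs
open import Data.Nat using (ℕ; zero; suc; _+_; _≤_; _<_; _<?_; _≤?_; _≟_; z≤n; s≤s; z<s)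
open import Data.Nat.Properties
open import Data.Fin using (Fin; toℕ; fromℕ<)
open import Data.Fin.Properties using (toℕ<n; fromℕ<-toℕ; toℕ-fromℕ<)
open import Data.Product using (∃; _×_; _,_; proj₁; proj₂)
open import Data.Sum using (_⊎_; inj₁; inj₂)
open import Function using (_∘_)
open import Relation.Nullary using (¬_; yes; no; contradiction)
open import Relation.Binary.PropositionalEquality

AllOn : ℕ → ℕ → (ℕ → Set) → Set
AllOn j l P = ∀ i → j ≤ i → i < j + l → P i

AllOn-empty : ∀ {P} j → AllOn j 0 P
AllOn-empty j i j≤i i<j+0 = contradiction j≤i (<⇒≱ (subst (i <_) (+-identityʳ j) i<j+0))

AllOn-head : ∀ {P} j l → AllOn j (suc l) P → P j
AllOn-head j l all = all j ≤-refl (m<m+n j z<s)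

AllOn-tail : ∀ {P} j l → AllOn j (suc l) P → AllOn (suc j) l P
AllOn-tail j l all i j<i i<end = all i (<⇒≤ j<i) (subst (i <_) (sym (+-suc j l)) i<end)

AllOn-cons : ∀ {P} j l → P j → AllOn (suc j) l P → AllOn j (suc l) P
AllOn-cons j l Pj all i j≤i i<end with m≤n⇒m<n∨m≡n j≤i
... | inj₁ j<i  = all i j<i (subst (i <_) (+-suc j l) i<end)
... | inj₂ refl = Pj

sumFrom : (ℕ → ℕ) → ℕ → ℕ → ℕ
sumFrom f j zero    = 0
sumFrom f j (suc l) = f j + sumFrom f (suc j) l

sumFrom-++ : ∀ f j L n → sumFrom f j (L + n) ≡ sumFrom f j L + sumFrom f (j + L) n
sumFrom-++ f j zero    n = cong (λ k → sumFrom f k n) (sym (+-identityʳ j))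
sumFrom-++ f j (suc L) n = begin
  f j + sumFrom f (suc j) (L + n)
    ≡⟨ cong (f j +_) (sumFrom-++ f (suc j) L n) ⟩
  f j + (sumFrom f (suc j) L + sumFrom f (suc j + L) n)
    ≡⟨ sym (+-assoc (f j) _ _) ⟩
  f j + sumFrom f (suc j) L + sumFrom f (suc j + L) n
    ≡⟨ cong (λ k → f j + sumFrom f (suc j) L + sumFrom f k n) (sym (+-suc j L)) ⟩
  f j + sumFrom f (suc j) L + sumFrom f (j + suc L) n
    ∎
  where open ≡-Reasoning

sumFrom-zero : ∀ {f} j l → AllOn j l (λ i → f i ≡ 0) → sumFrom f j l ≡ 0
sumFrom-zero j zero    _     = refl
sumFrom-zero j (suc l) zeros =
  cong₂ _+_ (AllOn-head j l zeros) (sumFrom-zero (suc j) l (AllOn-tail j l zeros))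

sumFrom-mono : ∀ {f g} j l → AllOn j l (λ i → g i ≤ f i) → sumFrom g j l ≤ sumFrom f j l
sumFrom-mono j zero    _   = z≤n
sumFrom-mono j (suc l) g≤f =
  +-mono-≤ (AllOn-head j l g≤f) (sumFrom-mono (suc j) l (AllOn-tail j l g≤f))

sumFrom-mono-< : ∀ {f g} j l → AllOn j l (λ i → g i ≤ f i) →
                 ∀ i → j ≤ i → i < j + l → g i < f i → sumFrom g j l < sumFrom f j l
sumFrom-mono-< j zero    _   i j≤i i<end _ = AllOn-empty j i j≤i i<end
sumFrom-mono-< j (suc l) g≤f i j≤i i<end gi<fi with m≤n⇒m<n∨m≡n j≤i
... | inj₂ refl = +-mono-<-≤ gi<fi (sumFrom-mono (suc j) l (AllOn-tail j l g≤f))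
... | inj₁ j<i  = +-mono-≤-< (AllOn-head j l g≤f)
  (sumFrom-mono-< (suc j) l (AllOn-tail j l g≤f) i j<i (subst (i <_) (+-suc j l) i<end) gi<fi)

lastPositive : ∀ (f : ℕ → ℕ) j l → AllOn j l (λ i → f i ≡ 0) ⊎
  ∃ λ i → j ≤ i × i < j + l × 0 < f i × (∀ k → i < k → k < j + l → f k ≡ 0)
lastPositive f j zero = inj₁ (AllOn-empty j)
lastPositive f j (suc l) with lastPositive f (suc j) l
... | inj₂ (i , j<i , i<end , pos , after) =
  inj₂ (i , <⇒≤ j<i , subst (i <_) (sym (+-suc j l)) i<end , pos ,
        λ k i<k k<end → after k i<k (subst (k <_) (+-suc j l) k<end))
... | inj₁ zeros with f j ≟ 0
...   | yes fj≡0 = inj₁ (AllOn-cons j l fj≡0 zeros)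
...   | no  fj≢0 = inj₂ (j , ≤-refl , m<m+n j z<s , n≢0⇒n>0 fj≢0 ,
                         λ k j<k k<end → zeros k j<k (subst (k <_) (+-suc j l) k<end))

firstPositive : ∀ (f : ℕ → ℕ) j l → AllOn j l (λ i → f i ≡ 0) ⊎
  ∃ λ i → j ≤ i × i < j + l × 0 < f i × (∀ k → j ≤ k → k < i → f k ≡ 0)
firstPositive f j zero = inj₁ (AllOn-empty j)
firstPositive f j (suc l) with f j ≟ 0
... | no fj≢0 = inj₂ (j , ≤-refl , m<m+n j z<s , n≢0⇒n>0 fj≢0 ,
                      λ k j≤k k<j → contradiction j≤k (<⇒≱ k<j))
... | yes fj≡0 with firstPositive f (suc j) l
...   | inj₁ zeros = inj₁ (AllOn-cons j l fj≡0 zeros)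
...   | inj₂ (i , j<i , i<end , pos , before) =
  inj₂ (i , <⇒≤ j<i , subst (i <_) (sym (+-suc j l)) i<end , pos ,
        zeroBefore)
  where
    zeroBefore : ∀ k → j ≤ k → k < i → f k ≡ 0
    zeroBefore k j≤k k<i with m≤n⇒m<n∨m≡n j≤k
    ... | inj₁ j<k  = before k j<k k<i
    ... | inj₂ refl = fj≡0

BlockBounded : (ℕ → ℕ) → Set
BlockBounded f = ∀ j l → sumFrom f j l ≤ suc l

sumFrom-decreased : ∀ {f g} j l → AllOn j l (λ i → g i ≤ f i) →
  AllOn j l (λ i → f i ≡ 0) ⊎ (∃ λ i → j ≤ i × i < j + l × g i < f i) →
  sumFrom f j l ≤ suc l → sumFrom g j l ≤ l
sumFrom-decreased j l g≤f (inj₁ zeros) _ =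
  ≤-trans (sumFrom-mono j l g≤f) (≤-trans (≤-reflexive (sumFrom-zero j l zeros)) z≤n)
sumFrom-decreased j l g≤f (inj₂ (i , j≤i , i<end , gi<fi)) f≤1+l =
  ≤-pred (<-≤-trans (sumFrom-mono-< j l g≤f i j≤i i<end gi<fi) f≤1+l)

record EntryMove (A B : ℕ → ℕ) (t : ℕ) : Set where
  field
    at-trigger     : B t ≡ 2
    non-increasing : ∀ i → i ≢ t → B i ≤ A i
    left-decrease  : ∀ i → i < t → 0 < A i → (∀ k → i < k → k < t → A k ≡ 0) → B i < A i
    right-decrease : ∀ i → t < i → 0 < A i → (∀ k → t < k → k < i → A k ≡ 0) → B i < A i

module _ {A B : ℕ → ℕ} where

  straddling-block-bounded : ∀ j L R → EntryMove A B (j + L) → BlockBounded A →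
                             sumFrom B j (L + suc R) ≤ suc (L + suc R)
  straddling-block-bounded j L R mv bounded = begin
    sumFrom B j (L + suc R)
      ≡⟨ sumFrom-++ B j L (suc R) ⟩
    sumFrom B j L + (B t + sumFrom B (suc t) R)
      ≡⟨ cong (λ b → sumFrom B j L + (b + sumFrom B (suc t) R)) at-trigger ⟩
    sumFrom B j L + (2 + sumFrom B (suc t) R)
      ≤⟨ +-mono-≤ leftPart (s≤s (s≤s rightPart)) ⟩
    L + suc (suc R)
      ≡⟨ +-suc L (suc R) ⟩
    suc (L + suc R)
      ∎
    where
      open EntryMove mv
      open ≤-Reasoning
      t : ℕ
      t = j + L

      leftDecrease : AllOn j L (λ i → A i ≡ 0) ⊎ (∃ λ i → j ≤ i × i < t × B i < A i)
      leftDecrease with lastPositive A j L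
      ... | inj₁ zeros = inj₁ zeros
      ... | inj₂ (i , j≤i , i<t , pos , after) =
        inj₂ (i , j≤i , i<t , left-decrease i i<t pos after)

      rightDecrease : AllOn (suc t) R (λ i → A i ≡ 0) ⊎ (∃ λ i → t < i × i < suc t + R × B i < A i)
      rightDecrease with firstPositive A (suc t) R
      ... | inj₁ zeros = inj₁ zeros
      ... | inj₂ (i , t<i , i<end , pos , before) =
        inj₂ (i , t<i , i<end , right-decrease i t<i pos before)

      leftPart : sumFrom B j L ≤ L
      leftPart = sumFrom-decreased j L (λ i _ i<t → non-increasing i (<⇒≢ i<t)) leftDecrease
                                   (bounded j L)

      rightPart : sumFrom B (suc t) R ≤ R
      rightPart = sumFrom-decreased (suc t) R (λ i t<i _ → non-increasing i (>⇒≢ t<i)) rightDecrease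
                                    (bounded (suc t) R)

  EntryMove-preserves-BlockBounded : ∀ {t} → EntryMove A B t → BlockBounded A → BlockBounded B
  EntryMove-preserves-BlockBounded {t} mv bounded j l with j + l ≤? t | t <? j
  ... | yes end≤t | _ =
    ≤-trans (sumFrom-mono j l λ i _ i<end → non-increasing i (<⇒≢ (<-≤-trans i<end end≤t))) (bounded j l)
    where open EntryMove mv
  ... | no _ | yes t<j =
    ≤-trans (sumFrom-mono j l λ i j≤i _ → non-increasing i (>⇒≢ (<-≤-trans t<j j≤i))) (bounded j l)
    where open EntryMove mv
  ... | no end≰t | no t≮j with m≤n⇒∃[o]m+o≡n (≮⇒≥ t≮j) | m≤n⇒∃[o]m+o≡n (≰⇒> end≰t)
  ...   | L , refl | R , t+1+R≡end = subst (λ l → sumFrom B j l ≤ suc l) lengths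
                                       (straddling-block-bounded j L R mv bounded)
    where
      lengths : L + suc R ≡ l
      lengths = +-cancelˡ-≡ j _ _ (begin
        j + (L + suc R)   ≡⟨ sym (+-assoc j L (suc R)) ⟩
        j + L + suc R     ≡⟨ +-suc (j + L) R ⟩
        suc (j + L) + R   ≡⟨ t+1+R≡end ⟩
        j + l             ∎)
        where open ≡-Reasoning

blockSum≡sumFrom : ∀ {m} (a : State m) j l → blockSum a j l ≡ sumFrom (entry a) j l
blockSum≡sumFrom a j zero    = refl
blockSum≡sumFrom a j (suc l) = cong (entry a j +_) (blockSum≡sumFrom a (suc j) l)

entry-toℕ : ∀ {m} (a : State m) k → entry a (toℕ k) ≡ a k
entry-toℕ {m} a k with toℕ k <? m
... | yes k<m = cong a (fromℕ<-toℕ k k<m)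
... | no  k≮m = contradiction (toℕ<n k) k≮m

entry-outside : ∀ {m} (a : State m) {i} → m ≤ i → entry a i ≡ 0
entry-outside {m} a {i} m≤i with i <? m
... | yes i<m = contradiction m≤i (<⇒≱ i<m)
... | no  _   = refl

entry-zeroState : ∀ m i → entry (zeroState m) i ≡ 0
entry-zeroState m i with i <? m
... | yes _ = refl
... | no  _ = refl

data Position (m : ℕ) : ℕ → Set where
  inside  : (k : Fin m) → Position m (toℕ k)
  outside : ∀ {i} → m ≤ i → Position m i

position : ∀ m i → Position m i
position m i with i <? m
... | yes i<m = subst (Position m) (toℕ-fromℕ< i<m) (inside (fromℕ< i<m))
... | no  i≮m = outside (≮⇒≥ i≮m)

Nearest⇒≢ : ∀ {m} {a : State m} {T k} → Nearest a T k → k ≢ T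
Nearest⇒≢ (inj₁ (k<T , _)) k≡T = <⇒≢ k<T (cong toℕ k≡T)
Nearest⇒≢ (inj₂ (T<k , _)) k≡T = >⇒≢ T<k (cong toℕ k≡T)

module _ {m : ℕ} {a a' : State m} {T : Fin m} (mv : MoveAt a T a') where

  private
    untouched : ∀ k → k ≢ T → (Nearest a T k → suc (a' k) ≡ a k) × (¬ Nearest a T k → a' k ≡ a k)
    untouched = proj₂ (proj₂ mv)

  -- Nearest a T k need not be decidable, so we decide a' k ≤ a k instead.
  MoveAt-≤ : ∀ k → k ≢ T → a' k ≤ a k
  MoveAt-≤ k k≢T with a' k ≤? a k
  ... | yes a'k≤ak = a'k≤ak
  ... | no  a'k≰ak = contradiction (≤-reflexive (proj₂ (untouched k k≢T) notNearest)) a'k≰ak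
    where
      notNearest : ¬ Nearest a T k
      notNearest near = a'k≰ak (<⇒≤ (≤-reflexive (proj₁ (untouched k k≢T) near)))

  MoveAt-< : ∀ k → Nearest a T k → a' k < a k
  MoveAt-< k near = ≤-reflexive (proj₁ (untouched k (Nearest⇒≢ near)) near)

  entryMove : EntryMove (entry a) (entry a') (toℕ T)
  entryMove = record
    { at-trigger     = trans (entry-toℕ a' T) (proj₁ (proj₂ mv))
    ; non-increasing = non-increasing
    ; left-decrease  = left-decrease
    ; right-decrease = right-decrease
    }
    where
      entry-< : ∀ k → a' k < a k → entry a' (toℕ k) < entry a (toℕ k)
      entry-< k = subst₂ _<_ (sym (entry-toℕ a' k)) (sym (entry-toℕ a k))

      non-increasing : ∀ i → i ≢ toℕ T → entry a' i ≤ entry a i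
      non-increasing i i≢T with position m i
      ... | inside k    = subst₂ _≤_ (sym (entry-toℕ a' k)) (sym (entry-toℕ a k))
                                     (MoveAt-≤ k (i≢T ∘ cong toℕ))
      ... | outside m≤i = ≤-reflexive (trans (entry-outside a' m≤i) (sym (entry-outside a m≤i)))

      left-decrease : ∀ i → i < toℕ T → 0 < entry a i →
                      (∀ k → i < k → k < toℕ T → entry a k ≡ 0) → entry a' i < entry a i
      left-decrease i i<T pos zeros with position m i
      ... | inside k    = entry-< k (MoveAt-< k (inj₁ (i<T , subst (0 <_) (entry-toℕ a k) pos ,
                            λ k' k<k' k'<T → trans (sym (entry-toℕ a k')) (zeros (toℕ k') k<k' k'<T))))
      ... | outside m≤i = contradiction (subst (0 <_) (entry-outside a m≤i) pos) (<-irrefl refl)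

      right-decrease : ∀ i → toℕ T < i → 0 < entry a i →
                       (∀ k → toℕ T < k → k < i → entry a k ≡ 0) → entry a' i < entry a i
      right-decrease i T<i pos zeros with position m i
      ... | inside k    = entry-< k (MoveAt-< k (inj₂ (T<i , subst (0 <_) (entry-toℕ a k) pos ,
                            λ k' T<k' k'<k → trans (sym (entry-toℕ a k')) (zeros (toℕ k') T<k' k'<k))))
      ... | outside m≤i = contradiction (subst (0 <_) (entry-outside a m≤i) pos) (<-irrefl refl)

Move-preserves-BlockBounded : ∀ {m} {a a' : State m} → Move a a' →
                              BlockBounded (entry a) → BlockBounded (entry a')
Move-preserves-BlockBounded (T , mv) = EntryMove-preserves-BlockBounded (entryMove mv)

zeroState-BlockBounded : ∀ m → BlockBounded (entry (zeroState m))
zeroState-BlockBounded m j l =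
  ≤-trans (≤-reflexive (sumFrom-zero j l (λ i _ _ → entry-zeroState m i))) z≤n

moveSequence-BlockBounded : ∀ {m n} {seq : Fin n → State m} → IsMoveSequenceFromZero seq →
                            ∀ k (k<n : k < n) → BlockBounded (entry (seq (fromℕ< k<n)))
moveSequence-BlockBounded {m} (starts , _) zero k<n =
  subst (BlockBounded ∘ entry) (sym (starts (fromℕ< k<n) (toℕ-fromℕ< k<n))) (zeroState-BlockBounded m)
moveSequence-BlockBounded {n = n} moves@(_ , steps) (suc k) k+1<n =
  Move-preserves-BlockBounded (steps (fromℕ< k<n) (fromℕ< k+1<n) consecutive)
                              (moveSequence-BlockBounded moves k k<n)
  where
    k<n : k < n
    k<n = <⇒≤ k+1<n
    consecutive : suc (toℕ (fromℕ< k<n)) ≡ toℕ (fromℕ< k+1<n)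
    consecutive = trans (cong suc (toℕ-fromℕ< k<n)) (sym (toℕ-fromℕ< k+1<n))

mainTheorem2 : (m n : ℕ) → 1 ≤ m → (seq : Fin n → State m) →
    IsMoveSequenceFromZero seq →
    ∀ (t : Fin n) (l j : ℕ) → 1 ≤ l → j + l ≤ m →
    blockSum (seq t) j l ≤ suc l
mainTheorem2 m n _ seq moves t l j _ _ =
  subst (_≤ suc l) (sym (blockSum≡sumFrom (seq t) j l)) (bounded j l)
  where
    bounded : BlockBounded (entry (seq t))
    bounded = subst (BlockBounded ∘ entry ∘ seq) (fromℕ<-toℕ t (toℕ<n t))
                    (moveSequence-BlockBounded moves (toℕ t) (toℕ<n t))
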